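{- For integers $d\ge 0$, $n\ge 2(d+1)$ and $\omega\ge 1$, \[ g_{n,d}(\omega)\le {\omega-1+2d \choose 2d} + {n-2 \choose 2d+1}, \] and the inequality is strict exactly when either ($d=0$, $\omega=1$, $n>2$) or ($d>0$, $n>\omega+2d+1$).
   Context: For $d\ge0$, $n\ge2(d+1)$, the function $g_{n,d}$ on positive integers is defined recursively by $g_{n,d}(1)=1$; $g_{n,0}(\omega)=n-1$ for $\omega>1$; and for $d>0,\omega>1$, $g_{n,d}(\omega)=\sum_{k=1}^{\omega}(\omega-k+1)\,g_{\max(n+k-\omega-2,2d),d-1}(k)$. -}

module Defs where

open import Data.Nat using (ℕ; zero; suc; _+_; _*_; _∸_; _⊔_)

sumFrom1 : ℕ → (ℕ → ℕ) → ℕ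
sumFrom1 zero    f = 0
sumFrom1 (suc m) f = sumFrom1 m f + f (suc m)

gd : ℕ → ℕ → ℕ → ℕ
gd d       n zero                = 0   -- junk value: ω ranges over positive integers
gd d       n (suc zero)          = 1
gd zero    n (suc (suc w))       = n ∸ 1
gd (suc d) n ω@(suc (suc w))     =
  sumFrom1 ω (λ k → (ω ∸ k + 1) * gd d (((n + k) ∸ (ω + 2)) ⊔ (2 * suc d)) k)

-- g n d ω = g_{n,d}(ω), parameter order as in the paper
g : ℕ → ℕ → ℕ → ℕ
g n d ω = gd d n ω

-- Bounding each summand of g_{n,d}(ω) by the bound for d - 1 splits the sum in two.
-- The first part, Σ_k (ω-k+1) C(k-1+2d-2, 2d-2), is C(ω-1+2d, 2d) by the hockey-stick identity applied
-- twice. The second is the partial sum Σ_{j<ω} (j+1) C(n-4-j, 2d-1) of a series with total C(n-2, 2d+1),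
-- whose omitted terms all vanish when n ≤ ω+2d+1. If n > ω+2d+1 the summand k = 1 is already strictly
-- below its bound by induction; otherwise every summand meets its bound, and so does the partial sum.
module Submission where

open import Defs
open import Data.Nat using (ℕ; _+_; _*_; _∸_; _≤_; _<_)
open import Data.Nat.Combinatorics using (_C_)
open import Data.Product using (_×_)
open import Data.Sum using (_⊎_)
open import Function.Bundles using (_⇔_)
open import Relation.Binary.PropositionalEquality using (_≡_)

open import Data.Nat using (zero; suc; _⊔_; s≤s; s≤s⁻¹; z≤n; _≤?_; _<?_; _≟_)
open import Data.Nat.Properties
open import Data.Nat.Combinatorics using (nCk+nC[k+1]≡[n+1]C[k+1]; k>n⇒nCk≡0; nCn≡1; nC1≡n)
open import Data.Nat.Tactic.RingSolver using (solve-∀)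
open import Data.Product using (∃-syntax; _,_; proj₁; proj₂)
open import Data.Sum using (inj₁; inj₂)
open import Data.Empty using (⊥-elim)
open import Function.Bundles using (mk⇔)
open import Relation.Binary.PropositionalEquality using (refl; sym; trans; cong; cong₂; subst; module ≡-Reasoning)
open import Relation.Nullary using (¬_; Dec; yes; no)
open import Relation.Nullary.Decidable using (_×-dec_; _⊎-dec_)

pascal : ∀ n k → suc n C suc k ≡ n C k + n C suc k
pascal n k = sym (nCk+nC[k+1]≡[n+1]C[k+1] n k)

0<nCk : ∀ {n k} → k ≤ n → 0 < n C k
0<nCk {n}     {zero}  _         = s≤s z≤n
0<nCk {suc n} {suc k} (s≤s k≤n) rewrite pascal n k = ≤-trans (0<nCk k≤n) (m≤m+n _ _)

[m⊔n]∸oCk≡m∸oCk : ∀ m {n o k} → n ∸ o < k → ((m ⊔ n) ∸ o) C k ≡ (m ∸ o) C k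
[m⊔n]∸oCk≡m∸oCk m {n} {o} {k} n∸o<k with m ≤? n
... | no  m≰n rewrite m≥n⇒m⊔n≡m (<⇒≤ (≰⇒> m≰n)) = refl
... | yes m≤n rewrite m≤n⇒m⊔n≡n m≤n =
  trans (k>n⇒nCk≡0 n∸o<k) (sym (k>n⇒nCk≡0 (≤-<-trans (∸-monoˡ-≤ o m≤n) n∸o<k)))

sumFrom1-cong : ∀ m {f h : ℕ → ℕ} → (∀ k → 1 ≤ k → k ≤ m → f k ≡ h k) →
                sumFrom1 m f ≡ sumFrom1 m h
sumFrom1-cong zero    eq = refl
sumFrom1-cong (suc m) eq =
  cong₂ _+_ (sumFrom1-cong m (λ k 1≤k k≤m → eq k 1≤k (m≤n⇒m≤1+n k≤m))) (eq (suc m) (s≤s z≤n) ≤-refl)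

sumFrom1-mono-≤ : ∀ m {f h : ℕ → ℕ} → (∀ k → 1 ≤ k → k ≤ m → f k ≤ h k) →
                  sumFrom1 m f ≤ sumFrom1 m h
sumFrom1-mono-≤ zero    le = z≤n
sumFrom1-mono-≤ (suc m) le =
  +-mono-≤ (sumFrom1-mono-≤ m (λ k 1≤k k≤m → le k 1≤k (m≤n⇒m≤1+n k≤m))) (le (suc m) (s≤s z≤n) ≤-refl)

sumFrom1-distrib-+ : ∀ m (f h : ℕ → ℕ) →
                     sumFrom1 m (λ k → f k + h k) ≡ sumFrom1 m f + sumFrom1 m h
sumFrom1-distrib-+ zero    f h = refl
sumFrom1-distrib-+ (suc m) f h rewrite sumFrom1-distrib-+ m f h =
  +-interchange (sumFrom1 m f) (sumFrom1 m h) (f (suc m)) (h (suc m))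
  where
  +-interchange : ∀ a b c d → a + b + (c + d) ≡ a + c + (b + d)
  +-interchange = solve-∀

sumFrom1-suc : ∀ m (f : ℕ → ℕ) → sumFrom1 (suc m) f ≡ f 1 + sumFrom1 m (λ k → f (suc k))
sumFrom1-suc zero    f = +-comm 0 (f 1)
sumFrom1-suc (suc m) f rewrite sumFrom1-suc m f = +-assoc (f 1) _ _

sumFrom1-mono-<-head : ∀ m {f h : ℕ → ℕ} → (∀ k → 1 ≤ k → k ≤ suc m → f k ≤ h k) → f 1 < h 1 →
                       sumFrom1 (suc m) f < sumFrom1 (suc m) h
sumFrom1-mono-<-head m {f} {h} le lt rewrite sumFrom1-suc m f | sumFrom1-suc m h =
  +-mono-<-≤ lt (sumFrom1-mono-≤ m (λ k _ k≤m → le (suc k) (s≤s z≤n) (s≤s k≤m)))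

weightedSum : ℕ → (ℕ → ℕ) → ℕ
weightedSum ω f = sumFrom1 ω (λ k → (ω ∸ k + 1) * f k)

weightedSum-suc : ∀ ω (f : ℕ → ℕ) → weightedSum (suc ω) f ≡ sumFrom1 (suc ω) f + weightedSum ω f
weightedSum-suc ω f = begin
  sumFrom1 ω (λ k → (suc ω ∸ k + 1) * f k) + (suc ω ∸ suc ω + 1) * f (suc ω)
    ≡⟨ cong₂ _+_ (sumFrom1-cong ω (λ k _ k≤ω → cong (λ x → (x + 1) * f k) (+-∸-assoc 1 k≤ω)))
                 (cong (λ x → (x + 1) * f (suc ω)) (n∸n≡0 ω)) ⟩
  sumFrom1 ω (λ k → f k + (ω ∸ k + 1) * f k) + (0 + 1) * f (suc ω)
    ≡⟨ cong₂ _+_ (sumFrom1-distrib-+ ω f (λ k → (ω ∸ k + 1) * f k)) (*-identityˡ (f (suc ω))) ⟩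
  sumFrom1 ω f + weightedSum ω f + f (suc ω)
    ≡⟨ +-rearrange (sumFrom1 ω f) (weightedSum ω f) (f (suc ω)) ⟩
  sumFrom1 ω f + f (suc ω) + weightedSum ω f ∎
  where
  open ≡-Reasoning
  +-rearrange : ∀ a b c → a + b + c ≡ a + c + b
  +-rearrange = solve-∀

hockeyStick : ∀ r m → sumFrom1 m (λ k → (k ∸ 1 + r) C r) ≡ (m + r) C suc r
hockeyStick r zero    = sym (k>n⇒nCk≡0 (n<1+n r))
hockeyStick r (suc m) rewrite hockeyStick r m =
  sym (trans (pascal (m + r) r) (+-comm ((m + r) C r) ((m + r) C suc r)))

weightedHockeyStick : ∀ r ω → weightedSum ω (λ k → (k ∸ 1 + r) C r) ≡ (ω + suc r) C suc (suc r)
weightedHockeyStick r zero    = sym (k>n⇒nCk≡0 (s≤s (s≤s (m≤n+m r 0))))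
weightedHockeyStick r (suc ω) = begin
  weightedSum (suc ω) (λ k → (k ∸ 1 + r) C r)
    ≡⟨ weightedSum-suc ω (λ k → (k ∸ 1 + r) C r) ⟩
  sumFrom1 (suc ω) (λ k → (k ∸ 1 + r) C r) + weightedSum ω (λ k → (k ∸ 1 + r) C r)
    ≡⟨ cong₂ _+_ (hockeyStick r (suc ω)) (weightedHockeyStick r ω) ⟩
  (suc ω + r) C suc r + (ω + suc r) C suc (suc r)
    ≡⟨ cong (λ x → x C suc r + (ω + suc r) C suc (suc r)) (sym (+-suc ω r)) ⟩
  (ω + suc r) C suc r + (ω + suc r) C suc (suc r)
    ≡⟨ pascal (ω + suc r) (suc r) ⟨
  (suc ω + suc r) C suc (suc r) ∎
  where open ≡-Reasoning

-- tailSum N r ω = Σ_{j<ω} (j+1) C(N-j, r), written as the weighted sum in which it arises.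
tailSum : ℕ → ℕ → ℕ → ℕ
tailSum N r ω = weightedSum ω (λ k → (N + k ∸ ω) C r)

tailSum-suc : ∀ N r ω → tailSum N r (suc ω) ≡ suc ω * ((N ∸ ω) C r) + tailSum N r ω
tailSum-suc N r ω = trans (sumFrom1-suc ω _) (cong₂ _+_ first rest)
  where
  first : (ω + 1) * ((N + 1 ∸ suc ω) C r) ≡ suc ω * ((N ∸ ω) C r)
  first = cong₂ (λ a b → a * ((b ∸ suc ω) C r)) (+-comm ω 1) (+-comm N 1)
  rest : sumFrom1 ω (λ k → (ω ∸ k + 1) * ((N + suc k ∸ suc ω) C r)) ≡ tailSum N r ω
  rest = sumFrom1-cong ω (λ k _ _ → cong (λ x → (ω ∸ k + 1) * ((x ∸ suc ω) C r)) (+-suc N k))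

-- The closed form of the missing part Σ_{j≥ω} (j+1) C(N-j, r) of the series.
tailRemainder : ℕ → ℕ → ℕ → ℕ
tailRemainder N r ω = (2 + N ∸ ω) C (2 + r) + ω * ((1 + N ∸ ω) C (1 + r))

-- 0 < r is needed: once ω > N the new summand is 0 C r, which is 1 for r = 0.
tailRemainder-suc : ∀ N r → 0 < r → ∀ ω →
                    suc ω * ((N ∸ ω) C r) + tailRemainder N r (suc ω) ≡ tailRemainder N r ω
tailRemainder-suc N r 0<r ω with ω ≤? N
... | yes ω≤N
  rewrite +-∸-assoc 1 ω≤N | +-∸-assoc 2 ω≤N
        | pascal (suc (N ∸ ω)) (suc r) | pascal (N ∸ ω) r =
  pascalRearranged ω ((N ∸ ω) C r) ((N ∸ ω) C suc r) (suc (N ∸ ω) C suc (suc r))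
  where
  pascalRearranged : ∀ w a b c → suc w * a + (c + suc w * b) ≡ (a + b) + c + w * (a + b)
  pascalRearranged = solve-∀
... | no ω≰N = beyondN (≰⇒> ω≰N)
  where
  2+N∸ω≤1 : N < ω → 2 + N ∸ ω ≤ 1
  2+N∸ω≤1 N<ω = m≤n+o⇒m∸n≤o (2 + N) ω (subst (2 + N ≤_) (+-comm 1 ω) (s≤s N<ω))
  beyondN : N < ω → suc ω * ((N ∸ ω) C r) + tailRemainder N r (suc ω) ≡ tailRemainder N r ω
  beyondN N<ω
    rewrite m≤n⇒m∸n≡0 (<⇒≤ N<ω) | m≤n⇒m∸n≡0 N<ω | k>n⇒nCk≡0 {0} {r} 0<r
          | k>n⇒nCk≡0 {2 + N ∸ ω} {2 + r} (s≤s (≤-trans (2+N∸ω≤1 N<ω) (s≤s z≤n)))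
          | *-zeroʳ ω = refl

tailSum+tailRemainder : ∀ N r → 0 < r → ∀ ω → tailSum N r ω + tailRemainder N r ω ≡ (2 + N) C (2 + r)
tailSum+tailRemainder N r 0<r zero    = +-identityʳ _
tailSum+tailRemainder N r 0<r (suc ω) = begin
  tailSum N r (suc ω) + tailRemainder N r (suc ω)
    ≡⟨ cong (_+ tailRemainder N r (suc ω)) (tailSum-suc N r ω) ⟩
  a + tailSum N r ω + tailRemainder N r (suc ω)
    ≡⟨ cong (_+ tailRemainder N r (suc ω)) (+-comm a (tailSum N r ω)) ⟩
  tailSum N r ω + a + tailRemainder N r (suc ω)
    ≡⟨ +-assoc (tailSum N r ω) a (tailRemainder N r (suc ω)) ⟩
  tailSum N r ω + (a + tailRemainder N r (suc ω))
    ≡⟨ cong (tailSum N r ω +_) (tailRemainder-suc N r 0<r ω) ⟩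
  tailSum N r ω + tailRemainder N r ω
    ≡⟨ tailSum+tailRemainder N r 0<r ω ⟩
  (2 + N) C (2 + r) ∎
  where
  open ≡-Reasoning
  a : ℕ
  a = suc ω * ((N ∸ ω) C r)

tailSum≤ : ∀ N r → 0 < r → ∀ ω → tailSum N r ω ≤ (2 + N) C (2 + r)
tailSum≤ N r 0<r ω = subst (tailSum N r ω ≤_) (tailSum+tailRemainder N r 0<r ω) (m≤m+n _ _)

tailRemainder≡0 : ∀ N r ω → 2 + N ≤ ω + r → tailRemainder N r ω ≡ 0
tailRemainder≡0 N r ω 2+N≤ω+r = cong₂ _+_
  (k>n⇒nCk≡0 (s≤s (m≤n+o⇒m∸n≤o (2 + N) ω (≤-trans 2+N≤ω+r (+-monoʳ-≤ ω (n≤1+n r))))))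
  (trans (cong (ω *_) (k>n⇒nCk≡0 (s≤s (m≤n+o⇒m∸n≤o (1 + N) ω (≤-trans (n≤1+n _) 2+N≤ω+r)))))
         (*-zeroʳ ω))

tailSum-complete : ∀ N r → 0 < r → ∀ ω → 2 + N ≤ ω + r → tailSum N r ω ≡ (2 + N) C (2 + r)
tailSum-complete N r 0<r ω 2+N≤ω+r = begin
  tailSum N r ω                           ≡⟨ +-identityʳ _ ⟨
  tailSum N r ω + 0                       ≡⟨ cong (tailSum N r ω +_) (tailRemainder≡0 N r ω 2+N≤ω+r) ⟨
  tailSum N r ω + tailRemainder N r ω     ≡⟨ tailSum+tailRemainder N r 0<r ω ⟩
  (2 + N) C (2 + r)                       ∎
  where open ≡-Reasoning

bound : ℕ → ℕ → ℕ → ℕ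
bound d n ω = ((ω ∸ 1 + 2 * d) C (2 * d)) + ((n ∸ 2) C (2 * d + 1))

StrictRegime : ℕ → ℕ → ℕ → Set
StrictRegime d n ω = (d ≡ 0 × ω ≡ 1 × 2 < n) ⊎ (0 < d × ω + 2 * d + 1 < n)

strictRegime? : ∀ d n ω → Dec (StrictRegime d n ω)
strictRegime? d n ω = (d ≟ 0 ×-dec (ω ≟ 1 ×-dec 2 <? n)) ⊎-dec (0 <? d ×-dec (ω + 2 * d + 1 <? n))

strictRegime-at-1 : ∀ d n → 1 + 2 * d + 1 < n → StrictRegime d n 1
strictRegime-at-1 zero    n 2<n = inj₁ (refl , refl , 2<n)
strictRegime-at-1 (suc d) n lt  = inj₂ (s≤s z≤n , lt)

¬strictRegime : ∀ d n ω → n ≤ ω + 2 * d + 1 → ¬ StrictRegime d n ω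
¬strictRegime zero    n ω n≤ω+1 (inj₁ (_ , refl , 2<n)) = <⇒≱ 2<n n≤ω+1
¬strictRegime (suc d) n ω n≤     (inj₂ (_ , lt))        = <⇒≱ lt n≤

Sharp : ℕ → ℕ → ℕ → Set
Sharp d n ω = (StrictRegime d n ω → g n d ω < bound d n ω)
            × (¬ StrictRegime d n ω → g n d ω ≡ bound d n ω)

Sharp⇒≤ : ∀ {d n ω} → Sharp d n ω → g n d ω ≤ bound d n ω
Sharp⇒≤ {d} {n} {ω} (strict , tight) with strictRegime? d n ω
... | yes regime  = <⇒≤ (strict regime)
... | no ¬regime = ≤-reflexive (tight ¬regime)

Sharp⇒<⇔ : ∀ {d n ω} → Sharp d n ω → (g n d ω < bound d n ω ⇔ StrictRegime d n ω)
Sharp⇒<⇔ {d} {n} {ω} (strict , tight) = mk⇔ regime-of-< strict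
  where
  regime-of-< : g n d ω < bound d n ω → StrictRegime d n ω
  regime-of-< lt with strictRegime? d n ω
  ... | yes regime  = regime
  ... | no ¬regime = ⊥-elim (<-irrefl (tight ¬regime) lt)

sharp-zero : ∀ n ω → 2 ≤ n → 1 ≤ ω → Sharp 0 n ω
sharp-zero n (suc zero) _ _ = strict , tight
  where
  bound≡ : bound 0 n 1 ≡ 1 + (n ∸ 2)
  bound≡ = cong suc (nC1≡n (n ∸ 2))
  strict : StrictRegime 0 n 1 → 1 < bound 0 n 1
  strict (inj₁ (_ , _ , 2<n)) rewrite bound≡ = s≤s (m<n⇒0<n∸m 2<n)
  tight : ¬ StrictRegime 0 n 1 → 1 ≡ bound 0 n 1
  tight ¬regime = sym (trans bound≡ (cong suc (m≤n⇒m∸n≡0 (≮⇒≥ (λ 2<n → ¬regime (inj₁ (refl , refl , 2<n)))))))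
sharp-zero (suc zero) (suc (suc w)) (s≤s ()) _
sharp-zero (suc (suc n)) (suc (suc w)) _ _ = (λ { (inj₁ (_ , () , _)) }) , λ _ → sym (cong suc (nC1≡n n))

sharp-at-1 : ∀ e n → Sharp (suc e) n 1
sharp-at-1 e n = strict , tight
  where
  d : ℕ
  d = suc e
  bound≡ : bound d n 1 ≡ 1 + (n ∸ 2) C (2 * d + 1)
  bound≡ = cong (_+ (n ∸ 2) C (2 * d + 1)) (nCn≡1 (2 * d))
  strict : StrictRegime d n 1 → 1 < bound d n 1
  strict (inj₂ (_ , lt)) rewrite bound≡ = s≤s (0<nCk (∸-monoˡ-≤ 2 lt))
  tight : ¬ StrictRegime d n 1 → 1 ≡ bound d n 1
  tight ¬regime = sym (trans bound≡ (cong suc (k>n⇒nCk≡0 n∸2<2d+1)))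
    where
    n≤2d+2 : n ≤ 1 + 2 * d + 1
    n≤2d+2 = ≮⇒≥ (λ lt → ¬regime (inj₂ (s≤s z≤n , lt)))
    n∸2<2d+1 : n ∸ 2 < 2 * d + 1
    n∸2<2d+1 = subst (n ∸ 2 <_) (+-comm 1 (2 * d))
                 (s≤s (subst (n ∸ 2 ≤_) (m+n∸n≡m (2 * d) 1) (∸-monoˡ-≤ 2 n≤2d+2)))

module Step (e N w : ℕ) (ih : ∀ n ω → 2 * (e + 1) ≤ n → 1 ≤ ω → Sharp e n ω) where

  n W r : ℕ
  n = 4 + N
  W = 2 + w
  r = 2 * e + 1

  0<r : 0 < r
  0<r = m≤n+m 1 (2 * e)

  m : ℕ → ℕ
  m k = (n + k ∸ (W + 2)) ⊔ (2 * suc e)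

  2[e+1]≤m : ∀ k → 2 * (e + 1) ≤ m k
  2[e+1]≤m k = subst (_≤ m k) (cong (2 *_) (+-comm 1 e)) (m≤n⊔m _ _)

  head : ℕ
  head = weightedSum W (λ k → (k ∸ 1 + 2 * e) C (2 * e))

  bound-at-m : ∀ k → bound e (m k) k ≡ (k ∸ 1 + 2 * e) C (2 * e) + (N + k ∸ W) C r
  bound-at-m k = cong ((k ∸ 1 + 2 * e) C (2 * e) +_) (begin
    (m k ∸ 2) C r                    ≡⟨ [m⊔n]∸oCk≡m∸oCk (n + k ∸ (W + 2)) {o = 2} 2e+2∸2<r ⟩
    (n + k ∸ (W + 2) ∸ 2) C r        ≡⟨ cong (_C r) (∸-+-assoc (n + k) (W + 2) 2) ⟩
    (n + k ∸ (W + 2 + 2)) C r        ≡⟨ cong (λ x → (n + k ∸ x) C r) (trans (+-assoc W 2 2) (+-comm W 4)) ⟩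
    (N + k ∸ W) C r                  ∎)
    where
    open ≡-Reasoning
    2e+2∸2<r : 2 * suc e ∸ 2 < r
    2e+2∸2<r = subst (λ x → suc (x ∸ 2) ≤ r) (sym (*-suc 2 e)) (≤-reflexive (+-comm 1 (2 * e)))

  weightedBound : ℕ
  weightedBound = weightedSum W (λ k → bound e (m k) k)

  weightedBound≡ : weightedBound ≡ head + tailSum N r W
  weightedBound≡ = trans (sumFrom1-cong W distrib) (sumFrom1-distrib-+ W _ _)
    where
    distrib : ∀ k → 1 ≤ k → k ≤ W → (W ∸ k + 1) * bound e (m k) k
            ≡ (W ∸ k + 1) * ((k ∸ 1 + 2 * e) C (2 * e)) + (W ∸ k + 1) * ((N + k ∸ W) C r)
    distrib k _ _ = trans (cong ((W ∸ k + 1) *_) (bound-at-m k)) (*-distribˡ-+ (W ∸ k + 1) _ _)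

  bound≡ : bound (suc e) n W ≡ head + (2 + N) C (2 + r)
  bound≡ = cong₂ _+_ (trans (cong₂ _C_ (upper w e) (*-suc 2 e)) (sym (weightedHockeyStick (2 * e) W)))
                     (cong ((2 + N) C_) (cong (_+ 1) (*-suc 2 e)))
    where
    upper : ∀ w e → suc w + 2 * suc e ≡ 2 + w + suc (2 * e)
    upper = solve-∀

  summand≤ : ∀ k → 1 ≤ k → k ≤ W → (W ∸ k + 1) * g (m k) e k ≤ (W ∸ k + 1) * bound e (m k) k
  summand≤ k 1≤k _ = *-monoʳ-≤ (W ∸ k + 1) (Sharp⇒≤ (ih (m k) k (2[e+1]≤m k) 1≤k))

  weightedBound≤bound : weightedBound ≤ bound (suc e) n W
  weightedBound≤bound = begin
    weightedBound               ≡⟨ weightedBound≡ ⟩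
    head + tailSum N r W        ≤⟨ +-monoʳ-≤ head (tailSum≤ N r 0<r W) ⟩
    head + (2 + N) C (2 + r)    ≡⟨ bound≡ ⟨
    bound (suc e) n W           ∎
    where open ≤-Reasoning

  -- Strictness comes from the first summand alone, where the inner parameter is largest.
  g<weightedBound : W + 2 * suc e + 1 < n → g n (suc e) W < weightedBound
  g<weightedBound lt = sumFrom1-mono-<-head (suc w) summand≤
    (*-monoʳ-< (W ∸ 1 + 1) (proj₁ (ih (m 1) 1 (2[e+1]≤m 1) ≤-refl) (strictRegime-at-1 e (m 1) 2e+2<m1)))
    where
    shift : ∀ W e → suc (W + 2 * suc e + 1) + 1 ≡ suc (1 + 2 * e + 1) + (W + 2)
    shift = solve-∀
    2e+2<m1 : 1 + 2 * e + 1 < m 1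
    2e+2<m1 = ≤-trans (m+n≤o⇒m≤o∸n _ (subst (_≤ n + 1) (shift W e) (+-monoˡ-≤ 1 lt))) (m≤m⊔n _ _)

  module Tight (n≤ : n ≤ W + 2 * suc e + 1) where

    m≤ : ∀ k → 1 ≤ k → m k ≤ k + 2 * e + 1
    m≤ k 1≤k = ⊔-lub (m≤n+o⇒m∸n≤o (n + k) (W + 2) (subst (n + k ≤_) (shift W e k) (+-monoˡ-≤ k n≤)))
                     (subst (_≤ k + 2 * e + 1) (sym (double e)) (+-monoˡ-≤ 1 (+-monoˡ-≤ (2 * e) 1≤k)))
      where
      double : ∀ e → 2 * suc e ≡ 1 + 2 * e + 1
      double = solve-∀
      shift : ∀ W e k → W + 2 * suc e + 1 + k ≡ W + 2 + (k + 2 * e + 1)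
      shift = solve-∀

    g≡weightedBound : g n (suc e) W ≡ weightedBound
    g≡weightedBound = sumFrom1-cong W (λ k 1≤k _ → cong ((W ∸ k + 1) *_)
      (proj₂ (ih (m k) k (2[e+1]≤m k) 1≤k) (¬strictRegime e (m k) k (m≤ k 1≤k))))

    tailSum≡ : tailSum N r W ≡ (2 + N) C (2 + r)
    tailSum≡ = tailSum-complete N r 0<r W (s≤s⁻¹ (s≤s⁻¹ (subst (n ≤_) (shift W e) n≤)))
      where
      shift : ∀ W e → W + 2 * suc e + 1 ≡ 2 + (W + (2 * e + 1))
      shift = solve-∀

  sharp : Sharp (suc e) n W
  sharp = strict , tight
    where
    strict : StrictRegime (suc e) n W → g n (suc e) W < bound (suc e) n W
    strict (inj₂ (_ , lt)) = <-≤-trans (g<weightedBound lt) weightedBound≤bound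
    tight : ¬ StrictRegime (suc e) n W → g n (suc e) W ≡ bound (suc e) n W
    tight ¬regime = begin
      g n (suc e) W               ≡⟨ g≡weightedBound ⟩
      weightedBound               ≡⟨ weightedBound≡ ⟩
      head + tailSum N r W        ≡⟨ cong (head +_) tailSum≡ ⟩
      head + (2 + N) C (2 + r)    ≡⟨ bound≡ ⟨
      bound (suc e) n W           ∎
      where
      open ≡-Reasoning
      open Tight (≮⇒≥ (λ lt → ¬regime (inj₂ (s≤s z≤n , lt))))

4+-view : ∀ e n → 2 * (suc e + 1) ≤ n → ∃[ N ] n ≡ 4 + N
4+-view e n 2d+2≤n = n ∸ 4 , sym (m+[n∸m]≡n (≤-trans (subst (4 ≤_) (sym (double e)) (m≤m+n 4 (2 * e))) 2d+2≤n))
  where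
  double : ∀ e → 2 * (suc e + 1) ≡ 4 + 2 * e
  double = solve-∀

sharp : ∀ d n ω → 2 * (d + 1) ≤ n → 1 ≤ ω → Sharp d n ω
sharp zero    n ω             2≤n    1≤ω = sharp-zero n ω 2≤n 1≤ω
sharp (suc e) n (suc zero)    _      _   = sharp-at-1 e n
sharp (suc e) n (suc (suc w)) 2d+2≤n _   with 4+-view e n 2d+2≤n
... | N , refl = Step.sharp e N w (sharp e)

mainTheorem8 : ∀ (d n ω : ℕ) → 2 * (d + 1) ≤ n → 1 ≤ ω →
    (g n d ω ≤ ((ω ∸ 1 + 2 * d) C (2 * d)) + ((n ∸ 2) C (2 * d + 1)))
    × ((g n d ω < ((ω ∸ 1 + 2 * d) C (2 * d)) + ((n ∸ 2) C (2 * d + 1)))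
    ⇔ ((d ≡ 0 × ω ≡ 1 × 2 < n) ⊎ (0 < d × ω + 2 * d + 1 < n)))
mainTheorem8 d n ω 2d+2≤n 1≤ω = Sharp⇒≤ sharpness , Sharp⇒<⇔ sharpness
  where
  sharpness : Sharp d n ω
  sharpness = sharp d n ω 2d+2≤n 1≤ω
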